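{- (1) For no atomic object $A$, canonical object $M_0$, variable $x_0$ and simple type $\rho_0$ do there exist both an atomic object $A'$ with $A[M_0/x_0]^o_{\rho_0}=A'$ and a canonical object $M$ and simple type $\rho$ with $A[M_0/x_0]^o_{\rho_0}=M:\rho$. (2) For any syntactic class $m$ and expression $T$, if $T[M_0/x_0]^m_{\rho_0}=T'$ and $T[M_0/x_0]^m_{\rho_0}=T''$, then $T'=T''$. (3) If $\Gamma\vdash_\Sigma \alpha\Rightarrow K$ and $\Gamma\vdash_\Sigma\alpha\Rightarrow K'$, then $K=K'$. (4) If $\Gamma\vdash_\Sigma A\Rightarrow\sigma$ and $\Gamma\vdash_\Sigma A\Rightarrow\sigma'$, then $\sigma=\sigma'$.
   Context: Syntax (of the canonical system CLLFP). Fix variables $x,y,\dots$, family constants $a$, object constants $c$, and a set of predicate symbols $\mathcal P$. Kinds $K::=\mathrm{Type}\mid \Pi x{:}\sigma.K$; atomic families $\alpha::=a\mid \alpha\,M$; canonical families $\sigma,\tau,\rho::=\alpha\mid \Pi x{:}\sigma.\tau\mid \mathcal L^{\mathcal P}_{N,\sigma}[\rho]$; atomic objects $A::=c\mid x\mid A\,M\mid \mathcal U^{\mathcal P}_{N,\sigma}[A]$; canonical objects $M,N::=A\mid \lambda x{:}\sigma.M\mid \mathcal L^{\mathcal P}_{N,\sigma}[M]$; signatures $\Sigma::=\emptyset\mid\Sigma,a{:}K\mid\Sigma,c{:}\sigma$; contexts $\Gamma::=\emptyset\mid \Gamma,x{:}\sigma$. $\Pi$ and $\lambda$ bind $x$;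 expressions are taken up to renaming of bound variables. Simple types $\rho::=a\mid \rho_1\to\rho_2\mid \mathcal L^{\mathcal P}_{N,\sigma}[\rho]$; erasure: $(a)^-=a$, $(\alpha M)^-=(\alpha)^-$, $(\Pi x{:}\sigma.\tau)^-=(\sigma)^-\to(\tau)^-$, $(\mathcal L^{\mathcal P}_{N,\sigma}[\tau])^-=\mathcal L^{\mathcal P}_{N,\sigma}[(\tau)^-]$. Hereditary substitution (write $T\mapsto^m T'$ for $T[M_0/x_0]^m_{\rho_0}=T'$, classes $K,f,F,O,C$; for atomic objects $A\mapsto^o A'$ with $A'$ atomic or $A\mapsto^o M':\rho$), inductively defined: $\mathrm{Type}\mapsto^K\mathrm{Type}$; $\Pi x{:}\sigma.K\mapsto^K\Pi x{:}\sigma'.K'$ if $\sigma\mapsto^F\sigma'$, $K\mapsto^K K'$; $a\mapsto^f a$; $\alpha M\mapsto^f\alpha'M'$ if $\alpha\mapsto^f\alpha'$, $M\mapsto^O M'$; $\alpha\mapsto^F\alpha'$ if $\alpha\mapsto^f\alpha'$; $\Pi x{:}\sigma_1.\sigma_2\mapsto^F\Pi x{:}\sigma_1'.\sigma_2'$ if $\sigma_i\mapsto^F\sigma_i'$; $\mathcal L^{\mathcal P}_{M_1,\sigma_1}[\sigma_2]\mapsto^F\mathcal L^{\mathcal P}_{M_1',\sigma_1'}[\sigma_2']$ if $\sigma_1\mapsto^F\sigma_1'$, $M_1\mapsto^O M_1'$, $\sigma_2\mapsto^F\sigma_2'$; $c\mapsto^o c$; $x_0\mapsto^o M_0:\rho_0$;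 $x\mapsto^o x$ ($x\ne x_0$); $A_1M_2\mapsto^o M':\rho$ if $A_1\mapsto^o(\lambda x{:}\sigma.M_1'):\rho_2\to\rho$, $M_2\mapsto^O M_2'$, $M_1'[M_2'/x]^O_{\rho_2}=M'$; $A_1M_2\mapsto^o A_1'M_2'$ if $A_1\mapsto^o A_1'$ (atomic), $M_2\mapsto^O M_2'$; $\mathcal U^{\mathcal P}_{M,\sigma}[A]\mapsto^o M_1:\rho$ if $\sigma\mapsto^F\sigma'$, $M\mapsto^O M'$, $A\mapsto^o\mathcal L^{\mathcal P}_{M',\sigma'}[M_1]:\mathcal L^{\mathcal P}_{M',\sigma'}[\rho]$; $\mathcal U^{\mathcal P}_{M,\sigma}[A]\mapsto^o\mathcal U^{\mathcal P}_{M',\sigma'}[A']$ if $\sigma\mapsto^F\sigma'$, $M\mapsto^O M'$, $A\mapsto^o A'$ (atomic); $A\mapsto^O A'$ if $A\mapsto^o A'$ (atomic); $A\mapsto^O M'$ if $A\mapsto^o M':\rho$; $\lambda x{:}\sigma.M\mapsto^O\lambda x{:}\sigma'.M'$ if $\sigma\mapsto^F\sigma'$, $M\mapsto^O M'$; $\mathcal L^{\mathcal P}_{M_1,\sigma_1}[M_2]\mapsto^O\mathcal L^{\mathcal P}_{M_1',\sigma_1'}[M_2']$ if $\sigma_1\mapsto^F\sigma_1'$, $M_1\mapsto^O M_1'$, $M_2\mapsto^O M_2'$; $\emptyset\mapsto^C\emptyset$; $(\Gamma,x{:}\sigma)\mapsto^C(\Gamma',x{:}\sigma')$ if $x\ne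 x_0$, $x\notin FV(M_0)$, $\Gamma\mapsto^C\Gamma'$, $\sigma\mapsto^F\sigma'$. Bound variables are chosen fresh. Typing. Each predicate symbol $\mathcal P$ denotes a property of judgements $\Gamma\vdash_\Sigma N\Leftarrow\sigma$. The judgements $\Sigma\ \mathrm{sig}$, $\vdash_\Sigma\Gamma$, $\Gamma\vdash_\Sigma K$, $\Gamma\vdash_\Sigma\sigma\ \mathrm{Type}$, $\Gamma\vdash_\Sigma\alpha\Rightarrow K$, $\Gamma\vdash_\Sigma A\Rightarrow\sigma$, $\Gamma\vdash_\Sigma M\Leftarrow\sigma$ are the least closed under: $\emptyset\ \mathrm{sig}$; $\Sigma,a{:}K\ \mathrm{sig}$ if $\Sigma\ \mathrm{sig}$, $\emptyset\vdash_\Sigma K$, $a\notin\mathrm{Dom}(\Sigma)$; $\Sigma,c{:}\sigma\ \mathrm{sig}$ if $\Sigma\ \mathrm{sig}$, $\emptyset\vdash_\Sigma\sigma\ \mathrm{Type}$, $c\notin\mathrm{Dom}(\Sigma)$; $\vdash_\Sigma\emptyset$ if $\Sigma\ \mathrm{sig}$; $\vdash_\Sigma\Gamma,x{:}\sigma$ if $\vdash_\Sigma\Gamma$, $\Gamma\vdash_\Sigma\sigma\ \mathrm{Type}$, $x\notin\mathrm{Dom}(\Gamma)$; $\Gamma\vdash\mathrm{Type}$ if $\vdash\Gamma$; $\Gamma\vdash\Pi x{:}\sigma.K$ if $\Gamma,x{:}\sigma\vdash K$; $\Gamma\vdash a\Rightarrow K$ if $\vdash\Gamma$, $a{:}K\in\Sigma$;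 $\Gamma\vdash\alpha M\Rightarrow K$ if $\Gamma\vdash\alpha\Rightarrow\Pi x{:}\sigma.K_1$, $\Gamma\vdash M\Leftarrow\sigma$, $K_1[M/x]^K_{(\sigma)^- }=K$; $\Gamma\vdash\alpha\ \mathrm{Type}$ if $\Gamma\vdash\alpha\Rightarrow\mathrm{Type}$; $\Gamma\vdash\Pi x{:}\sigma.\tau\ \mathrm{Type}$ if $\Gamma,x{:}\sigma\vdash\tau\ \mathrm{Type}$; $\Gamma\vdash\mathcal L^{\mathcal P}_{N,\sigma}[\rho]\ \mathrm{Type}$ if $\Gamma\vdash\rho\ \mathrm{Type}$, $\Gamma\vdash N\Leftarrow\sigma$; $\Gamma\vdash\mathcal L^{\mathcal P}_{S,\sigma}[\rho']\ \mathrm{Type}$ if $\Gamma,x{:}\tau\vdash\mathcal L^{\mathcal P}_{S,\sigma}[\rho]\ \mathrm{Type}$, $\Gamma\vdash A\Rightarrow\mathcal L^{\mathcal P}_{S,\sigma}[\tau]$, $\rho[\mathcal U^{\mathcal P}_{S,\sigma}[A]/x]^F_{(\tau)^- }=\rho'$; $\Gamma\vdash c\Rightarrow\sigma$ if $\vdash\Gamma$, $c{:}\sigma\in\Sigma$; $\Gamma\vdash x\Rightarrow\sigma$ if $\vdash\Gamma$, $x{:}\sigma\in\Gamma$; $\Gamma\vdash AM\Rightarrow\tau$ if $\Gamma\vdash A\Rightarrow\Pi x{:}\sigma.\tau_1$, $\Gamma\vdash M\Leftarrow\sigma$, $\tau_1[M/x]^F_{(\sigma)^- }=\tau$; $\Gamma\vdash\mathcal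 U^{\mathcal P}_{N,\sigma}[A]\Rightarrow\rho$ if $\Gamma\vdash A\Rightarrow\mathcal L^{\mathcal P}_{N,\sigma}[\rho]$, $\Gamma\vdash N\Leftarrow\sigma$ and $\mathcal P(\Gamma\vdash N\Leftarrow\sigma)$ holds; $\Gamma\vdash A\Leftarrow\alpha$ if $\Gamma\vdash A\Rightarrow\alpha$ with $\alpha$ an atomic family; $\Gamma\vdash\lambda x{:}\sigma.M\Leftarrow\Pi x{:}\sigma.\tau$ if $\Gamma,x{:}\sigma\vdash M\Leftarrow\tau$; $\Gamma\vdash\mathcal L^{\mathcal P}_{N,\sigma}[M]\Leftarrow\mathcal L^{\mathcal P}_{N,\sigma}[\rho]$ if $\Gamma\vdash M\Leftarrow\rho$, $\Gamma\vdash N\Leftarrow\sigma$; $\Gamma\vdash\mathcal L^{\mathcal P}_{S,\sigma}[M']\Leftarrow\mathcal L^{\mathcal P}_{S,\sigma}[\rho']$ if $\Gamma,x{:}\tau\vdash\mathcal L^{\mathcal P}_{S,\sigma}[M]\Leftarrow\mathcal L^{\mathcal P}_{S,\sigma}[\rho]$, $\Gamma\vdash A\Rightarrow\mathcal L^{\mathcal P}_{S,\sigma}[\tau]$, $\rho[\mathcal U^{\mathcal P}_{S,\sigma}[A]/x]^F_{(\tau)^- }=\rho'$, $M[\mathcal U^{\mathcal P}_{S,\sigma}[A]/x]^O_{(\tau)^- }=M'$. -}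

module Defs where

-- Canonical system CLLFP, rendered with de Bruijn indices
-- (expressions are identified up to renaming of bound variables).
-- Conventions:
--  * variables are de Bruijn indices (var 0 = innermost binder);
--  * binders: the body of  Πk σ K,  Π σ τ,  lam σ M  lives in the scope
--    extended by one variable; the subscripts N, σ of L/U are not binders;
--  * family constants and object constants are named by natural numbers;
--  * predicate symbols range over an arbitrary type PSym.

open import Data.Nat using (ℕ; zero; suc; _+_; _<_; _≤_; _<ᵇ_)
open import Data.Bool using (if_then_else_)
open import Data.Product using (Σ-syntax)
open import Relation.Nullary using (¬_)

module CLLFP (PSym : Set) where

  data Kind : Set
  data AFam : Set
  data Fam  : Set
  data Atom : Set
  data Obj  : Set

  data Kind where
    Type : Kind
    Πk   : Fam → Kind → Kind

  data AFam where
    fconst : ℕ → AFam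
    fapp   : AFam → Obj → AFam

  data Fam where
    atom : AFam → Fam
    Π    : Fam → Fam → Fam
    Lf   : PSym → Obj → Fam → Fam → Fam

  data Atom where
    const : ℕ → Atom
    var   : ℕ → Atom
    app   : Atom → Obj → Atom
    U     : PSym → Obj → Fam → Atom → Atom

  data Obj where
    at  : Atom → Obj
    lam : Fam → Obj → Obj
    Lo  : PSym → Obj → Fam → Obj → Obj

  data SType : Set where
    base : ℕ → SType
    _⇒_  : SType → SType → SType
    Ls   : PSym → Obj → Fam → SType → SType

  eraseA : AFam → ℕ
  eraseA (fconst a) = a
  eraseA (fapp α M) = eraseA α

  erase : Fam → SType
  erase (atom α)     = base (eraseA α)
  erase (Π σ τ)      = erase σ ⇒ erase τ
  erase (Lf P N σ τ) = Ls P N σ (erase τ)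

  shiftK  : ℕ → Kind → Kind
  shiftAF : ℕ → AFam → AFam
  shiftF  : ℕ → Fam → Fam
  shiftA  : ℕ → Atom → Atom
  shiftO  : ℕ → Obj → Obj

  shiftK c Type       = Type
  shiftK c (Πk σ K)   = Πk (shiftF c σ) (shiftK (suc c) K)
  shiftAF c (fconst a) = fconst a
  shiftAF c (fapp α M) = fapp (shiftAF c α) (shiftO c M)
  shiftF c (atom α)     = atom (shiftAF c α)
  shiftF c (Π σ τ)      = Π (shiftF c σ) (shiftF (suc c) τ)
  shiftF c (Lf P N σ ρ) = Lf P (shiftO c N) (shiftF c σ) (shiftF c ρ)
  shiftA c (const k)   = const k
  shiftA c (var x)     = if x <ᵇ c then var x else var (suc x)
  shiftA c (app A M)   = app (shiftA c A) (shiftO c M)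
  shiftA c (U P N σ A) = U P (shiftO c N) (shiftF c σ) (shiftA c A)
  shiftO c (at A)       = at (shiftA c A)
  shiftO c (lam σ M)    = lam (shiftF c σ) (shiftO (suc c) M)
  shiftO c (Lo P N σ M) = Lo P (shiftO c N) (shiftF c σ) (shiftO c M)

  shiftS : ℕ → SType → SType
  shiftS c (base a)     = base a
  shiftS c (ρ₁ ⇒ ρ₂)    = shiftS c ρ₁ ⇒ shiftS c ρ₂
  shiftS c (Ls P N σ ρ) = Ls P (shiftO c N) (shiftF c σ) (shiftS c ρ)

  shiftO* : ℕ → Obj → Obj
  shiftO* zero    M = M
  shiftO* (suc n) M = shiftO 0 (shiftO* n M)

  shiftS* : ℕ → SType → SType
  shiftS* zero    ρ = ρ
  shiftS* (suc n) ρ = shiftS 0 (shiftS* n ρ)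

  infixl 5 _,_
  data Ctx : Set where
    ∅   : Ctx
    _,_ : Ctx → Fam → Ctx

  len : Ctx → ℕ
  len ∅       = 0
  len (Γ , σ) = suc (len Γ)

  data Decl : Set where
    famDecl : ℕ → Kind → Decl
    objDecl : ℕ → Fam → Decl

  infixl 5 _▷_
  data Sig : Set where
    ∅   : Sig
    _▷_ : Sig → Decl → Sig

  data _∋f_∶_ : Sig → ℕ → Kind → Set where
    here  : ∀ {Σ a K} → (Σ ▷ famDecl a K) ∋f a ∶ K
    there : ∀ {Σ a K d} → Σ ∋f a ∶ K → (Σ ▷ d) ∋f a ∶ K

  data _∋o_∶_ : Sig → ℕ → Fam → Set where
    here  : ∀ {Σ c σ} → (Σ ▷ objDecl c σ) ∋o c ∶ σ
    there : ∀ {Σ c σ d} → Σ ∋o c ∶ σ → (Σ ▷ d) ∋o c ∶ σ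

  -- x : σ ∈ Γ  (the type is weakened into the scope of Γ)
  data _∋_∶_ : Ctx → ℕ → Fam → Set where
    here  : ∀ {Γ σ} → (Γ , σ) ∋ 0 ∶ shiftF 0 σ
    there : ∀ {Γ x σ τ} → Γ ∋ x ∶ σ → (Γ , τ) ∋ suc x ∶ shiftF 0 σ

  -- Hereditary substitution  T[M₀/x₀]^m_{ρ₀} = T'
  -- Index convention: x₀ is the de Bruijn index of the substituted
  -- variable; M₀ and ρ₀ live in the scope of the result.

  data ARes : Set where
    atomic : Atom → ARes
    canon  : Obj → SType → ARes

  data SubK  : ℕ → Obj → SType → Kind → Kind → Set
  data SubAF : ℕ → Obj → SType → AFam → AFam → Set
  data SubF  : ℕ → Obj → SType → Fam → Fam → Set
  data SubA  : ℕ → Obj → SType → Atom → ARes → Set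
  data SubO  : ℕ → Obj → SType → Obj → Obj → Set

  data SubK where
    s-Type : ∀ {x₀ M₀ ρ₀} → SubK x₀ M₀ ρ₀ Type Type
    s-Πk   : ∀ {x₀ M₀ ρ₀ σ σ' K K'} →
             SubF x₀ M₀ ρ₀ σ σ' →
             SubK (suc x₀) (shiftO 0 M₀) (shiftS 0 ρ₀) K K' →
             SubK x₀ M₀ ρ₀ (Πk σ K) (Πk σ' K')

  data SubAF where
    s-fconst : ∀ {x₀ M₀ ρ₀ a} → SubAF x₀ M₀ ρ₀ (fconst a) (fconst a)
    s-fapp   : ∀ {x₀ M₀ ρ₀ α α' M M'} →
               SubAF x₀ M₀ ρ₀ α α' → SubO x₀ M₀ ρ₀ M M' →
               SubAF x₀ M₀ ρ₀ (fapp α M) (fapp α' M')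

  data SubF where
    s-atom : ∀ {x₀ M₀ ρ₀ α α'} →
             SubAF x₀ M₀ ρ₀ α α' → SubF x₀ M₀ ρ₀ (atom α) (atom α')
    s-Π    : ∀ {x₀ M₀ ρ₀ σ₁ σ₁' σ₂ σ₂'} →
             SubF x₀ M₀ ρ₀ σ₁ σ₁' →
             SubF (suc x₀) (shiftO 0 M₀) (shiftS 0 ρ₀) σ₂ σ₂' →
             SubF x₀ M₀ ρ₀ (Π σ₁ σ₂) (Π σ₁' σ₂')
    s-Lf   : ∀ {x₀ M₀ ρ₀ P M₁ M₁' σ₁ σ₁' σ₂ σ₂'} →
             SubF x₀ M₀ ρ₀ σ₁ σ₁' → SubO x₀ M₀ ρ₀ M₁ M₁' →
             SubF x₀ M₀ ρ₀ σ₂ σ₂' →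
             SubF x₀ M₀ ρ₀ (Lf P M₁ σ₁ σ₂) (Lf P M₁' σ₁' σ₂')

  data SubA where
    s-const  : ∀ {x₀ M₀ ρ₀ c} → SubA x₀ M₀ ρ₀ (const c) (atomic (const c))
    s-var≡   : ∀ {x₀ M₀ ρ₀} → SubA x₀ M₀ ρ₀ (var x₀) (canon M₀ ρ₀)
    s-var<   : ∀ {x₀ M₀ ρ₀ x} → x < x₀ →
               SubA x₀ M₀ ρ₀ (var x) (atomic (var x))
    s-var>   : ∀ {x₀ M₀ ρ₀ x} → x₀ ≤ x →
               SubA x₀ M₀ ρ₀ (var (suc x)) (atomic (var x))
    s-app-c  : ∀ {x₀ M₀ ρ₀ A₁ σ M₁' ρ₂ ρ M₂ M₂' M'} →
               SubA x₀ M₀ ρ₀ A₁ (canon (lam σ M₁') (ρ₂ ⇒ ρ)) →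
               SubO x₀ M₀ ρ₀ M₂ M₂' →
               SubO 0 M₂' ρ₂ M₁' M' →
               SubA x₀ M₀ ρ₀ (app A₁ M₂) (canon M' ρ)
    s-app-a  : ∀ {x₀ M₀ ρ₀ A₁ A₁' M₂ M₂'} →
               SubA x₀ M₀ ρ₀ A₁ (atomic A₁') →
               SubO x₀ M₀ ρ₀ M₂ M₂' →
               SubA x₀ M₀ ρ₀ (app A₁ M₂) (atomic (app A₁' M₂'))
    s-U-c    : ∀ {x₀ M₀ ρ₀ P M M' σ σ' A M₁ ρ} →
               SubF x₀ M₀ ρ₀ σ σ' → SubO x₀ M₀ ρ₀ M M' →
               SubA x₀ M₀ ρ₀ A (canon (Lo P M' σ' M₁) (Ls P M' σ' ρ)) →
               SubA x₀ M₀ ρ₀ (U P M σ A) (canon M₁ ρ)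
    s-U-a    : ∀ {x₀ M₀ ρ₀ P M M' σ σ' A A'} →
               SubF x₀ M₀ ρ₀ σ σ' → SubO x₀ M₀ ρ₀ M M' →
               SubA x₀ M₀ ρ₀ A (atomic A') →
               SubA x₀ M₀ ρ₀ (U P M σ A) (atomic (U P M' σ' A'))

  data SubO where
    s-at-a : ∀ {x₀ M₀ ρ₀ A A'} →
             SubA x₀ M₀ ρ₀ A (atomic A') → SubO x₀ M₀ ρ₀ (at A) (at A')
    s-at-c : ∀ {x₀ M₀ ρ₀ A M' ρ} →
             SubA x₀ M₀ ρ₀ A (canon M' ρ) → SubO x₀ M₀ ρ₀ (at A) M'
    s-lam  : ∀ {x₀ M₀ ρ₀ σ σ' M M'} →
             SubF x₀ M₀ ρ₀ σ σ' →
             SubO (suc x₀) (shiftO 0 M₀) (shiftS 0 ρ₀) M M' →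
             SubO x₀ M₀ ρ₀ (lam σ M) (lam σ' M')
    s-Lo   : ∀ {x₀ M₀ ρ₀ P M₁ M₁' σ₁ σ₁' M₂ M₂'} →
             SubF x₀ M₀ ρ₀ σ₁ σ₁' → SubO x₀ M₀ ρ₀ M₁ M₁' →
             SubO x₀ M₀ ρ₀ M₂ M₂' →
             SubO x₀ M₀ ρ₀ (Lo P M₁ σ₁ M₂) (Lo P M₁' σ₁' M₂')

  -- contexts: Γ is a telescope of declarations following x₀
  -- (each entry lies in the scope of x₀ and the earlier entries)
  data SubC : ℕ → Obj → SType → Ctx → Ctx → Set where
    s-∅   : ∀ {x₀ M₀ ρ₀} → SubC x₀ M₀ ρ₀ ∅ ∅
    s-ext : ∀ {x₀ M₀ ρ₀ Γ Γ' σ σ'} →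
            SubC x₀ M₀ ρ₀ Γ Γ' →
            SubF (len Γ + x₀) (shiftO* (len Γ) M₀) (shiftS* (len Γ) ρ₀) σ σ' →
            SubC x₀ M₀ ρ₀ (Γ , σ) (Γ' , σ')

  -- Typing, relative to an interpretation of the predicate symbols as
  -- properties of judgements  Γ ⊢_Σ N ⇐ σ.

  module Typing (Pint : PSym → Sig → Ctx → Obj → Fam → Set) where

    data SigOK    : Sig → Set
    data CtxOK    : Sig → Ctx → Set
    data KindOK   : Sig → Ctx → Kind → Set
    data FamOK    : Sig → Ctx → Fam → Set
    data AFamSyn  : Sig → Ctx → AFam → Kind → Set
    data AtomSyn  : Sig → Ctx → Atom → Fam → Set
    data ObjChk   : Sig → Ctx → Obj → Fam → Set

    data SigOK where
      sig-∅   : SigOK ∅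
      sig-fam : ∀ {Σ a K} → SigOK Σ → KindOK Σ ∅ K →
                ¬ (Σ[ K' ∈ Kind ] (Σ ∋f a ∶ K')) →
                SigOK (Σ ▷ famDecl a K)
      sig-obj : ∀ {Σ c σ} → SigOK Σ → FamOK Σ ∅ σ →
                ¬ (Σ[ σ' ∈ Fam ] (Σ ∋o c ∶ σ')) →
                SigOK (Σ ▷ objDecl c σ)

    data CtxOK where
      ctx-∅   : ∀ {Σ} → SigOK Σ → CtxOK Σ ∅
      ctx-ext : ∀ {Σ Γ σ} → CtxOK Σ Γ → FamOK Σ Γ σ → CtxOK Σ (Γ , σ)

    data KindOK where
      k-Type : ∀ {Σ Γ} → CtxOK Σ Γ → KindOK Σ Γ Type
      k-Π    : ∀ {Σ Γ σ K} → KindOK Σ (Γ , σ) K → KindOK Σ Γ (Πk σ K)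

    data AFamSyn where
      af-const : ∀ {Σ Γ a K} → CtxOK Σ Γ → Σ ∋f a ∶ K →
                 AFamSyn Σ Γ (fconst a) K
      af-app   : ∀ {Σ Γ α σ K₁ M K} →
                 AFamSyn Σ Γ α (Πk σ K₁) → ObjChk Σ Γ M σ →
                 SubK 0 M (erase σ) K₁ K →
                 AFamSyn Σ Γ (fapp α M) K

    data FamOK where
      f-atom : ∀ {Σ Γ α} → AFamSyn Σ Γ α Type → FamOK Σ Γ (atom α)
      f-Π    : ∀ {Σ Γ σ τ} → FamOK Σ (Γ , σ) τ → FamOK Σ Γ (Π σ τ)
      f-L    : ∀ {Σ Γ P N σ ρ} → FamOK Σ Γ ρ → ObjChk Σ Γ N σ →
               FamOK Σ Γ (Lf P N σ ρ)
      f-L'   : ∀ {Σ Γ P S σ τ ρ ρ' A} →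
               FamOK Σ (Γ , τ) (Lf P (shiftO 0 S) (shiftF 0 σ) ρ) →
               AtomSyn Σ Γ A (Lf P S σ τ) →
               SubF 0 (at (U P S σ A)) (erase τ) ρ ρ' →
               FamOK Σ Γ (Lf P S σ ρ')

    data AtomSyn where
      a-const : ∀ {Σ Γ c σ} → CtxOK Σ Γ → Σ ∋o c ∶ σ →
                AtomSyn Σ Γ (const c) σ
      a-var   : ∀ {Σ Γ x σ} → CtxOK Σ Γ → Γ ∋ x ∶ σ →
                AtomSyn Σ Γ (var x) σ
      a-app   : ∀ {Σ Γ A σ τ₁ M τ} →
                AtomSyn Σ Γ A (Π σ τ₁) → ObjChk Σ Γ M σ →
                SubF 0 M (erase σ) τ₁ τ →
                AtomSyn Σ Γ (app A M) τ
      a-U     : ∀ {Σ Γ P N σ A ρ} →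
                AtomSyn Σ Γ A (Lf P N σ ρ) → ObjChk Σ Γ N σ →
                Pint P Σ Γ N σ →
                AtomSyn Σ Γ (U P N σ A) ρ

    data ObjChk where
      o-atom : ∀ {Σ Γ A α} → AtomSyn Σ Γ A (atom α) →
               ObjChk Σ Γ (at A) (atom α)
      o-lam  : ∀ {Σ Γ σ M τ} → ObjChk Σ (Γ , σ) M τ →
               ObjChk Σ Γ (lam σ M) (Π σ τ)
      o-L    : ∀ {Σ Γ P N σ M ρ} → ObjChk Σ Γ M ρ → ObjChk Σ Γ N σ →
               ObjChk Σ Γ (Lo P N σ M) (Lf P N σ ρ)
      o-L'   : ∀ {Σ Γ P S σ τ M M' ρ ρ' A} →
               ObjChk Σ (Γ , τ) (Lo P (shiftO 0 S) (shiftF 0 σ) M)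
                                (Lf P (shiftO 0 S) (shiftF 0 σ) ρ) →
               AtomSyn Σ Γ A (Lf P S σ τ) →
               SubF 0 (at (U P S σ A)) (erase τ) ρ ρ' →
               SubO 0 (at (U P S σ A)) (erase τ) M M' →
               ObjChk Σ Γ (Lo P S σ M') (Lf P S σ ρ')

module Submission where

-- Every substitution judgement is syntax-directed: for a given input at most one
-- rule applies, except for the pairs of rules (s-var≡ / s-var< / s-var>,
-- s-app-c / s-app-a, s-U-c / s-U-a, s-at-a / s-at-c) that are told apart by the
-- position of the variable or by the shape of the result of the recursive call.
-- Functionality therefore follows by simultaneous induction on the two
-- derivations, and (1) is the special case where the two results have different
-- shapes. For (3) and (4), well-formed signatures declare each constant once, so
-- the head of an atomic family or object has a unique type; the applied or
-- unlocked type is then unique because hereditary substitution is functional.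

open import Defs
open import Data.Nat using (ℕ)
open import Data.Nat.Properties using (≤-trans; n≤1+n; <⇒≱; n≮n)
open import Data.Product using (_×_; _,_)
open import Data.Empty using (⊥-elim)
open import Relation.Nullary using (¬_)
open import Relation.Binary.PropositionalEquality using (_≡_; refl; cong; cong₂)

module _ {PSym : Set} where
  open CLLFP PSym hiding (_,_)

  SubK-functional  : ∀ {x₀ M₀ ρ₀} {T T' T'' : Kind} →
                     SubK x₀ M₀ ρ₀ T T' → SubK x₀ M₀ ρ₀ T T'' → T' ≡ T''
  SubAF-functional : ∀ {x₀ M₀ ρ₀} {T T' T'' : AFam} →
                     SubAF x₀ M₀ ρ₀ T T' → SubAF x₀ M₀ ρ₀ T T'' → T' ≡ T''
  SubF-functional  : ∀ {x₀ M₀ ρ₀} {T T' T'' : Fam} →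
                     SubF x₀ M₀ ρ₀ T T' → SubF x₀ M₀ ρ₀ T T'' → T' ≡ T''
  SubA-functional  : ∀ {x₀ M₀ ρ₀} {T : Atom} {T' T'' : ARes} →
                     SubA x₀ M₀ ρ₀ T T' → SubA x₀ M₀ ρ₀ T T'' → T' ≡ T''
  SubO-functional  : ∀ {x₀ M₀ ρ₀} {T T' T'' : Obj} →
                     SubO x₀ M₀ ρ₀ T T' → SubO x₀ M₀ ρ₀ T T'' → T' ≡ T''

  SubK-functional s-Type     s-Type       = refl
  SubK-functional (s-Πk σ K) (s-Πk σ' K') =
    cong₂ Πk (SubF-functional σ σ') (SubK-functional K K')

  SubAF-functional s-fconst     s-fconst       = refl
  SubAF-functional (s-fapp α M) (s-fapp α' M') =
    cong₂ fapp (SubAF-functional α α') (SubO-functional M M')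

  SubF-functional (s-atom α)   (s-atom α')     = cong atom (SubAF-functional α α')
  SubF-functional (s-Π σ τ)    (s-Π σ' τ')     =
    cong₂ Π (SubF-functional σ σ') (SubF-functional τ τ')
  SubF-functional (s-Lf σ N ρ) (s-Lf σ' N' ρ')
    with SubF-functional σ σ' | SubO-functional N N' | SubF-functional ρ ρ'
  ... | refl | refl | refl = refl

  SubA-functional s-const    s-const    = refl
  SubA-functional s-var≡     s-var≡     = refl
  SubA-functional s-var≡     (s-var< p) = ⊥-elim (n≮n _ p)
  SubA-functional s-var≡     (s-var> p) = ⊥-elim (n≮n _ p)
  SubA-functional (s-var< p) s-var≡     = ⊥-elim (n≮n _ p)
  SubA-functional (s-var< p) (s-var< q) = refl
  SubA-functional (s-var< p) (s-var> q) = ⊥-elim (<⇒≱ p (≤-trans q (n≤1+n _)))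
  SubA-functional (s-var> p) s-var≡     = ⊥-elim (n≮n _ p)
  SubA-functional (s-var> p) (s-var< q) = ⊥-elim (<⇒≱ q (≤-trans p (n≤1+n _)))
  SubA-functional (s-var> p) (s-var> q) = refl
  SubA-functional (s-app-c A M body) (s-app-c A' M' body')
    with SubA-functional A A' | SubO-functional M M'
  ... | refl | refl = cong₂ canon (SubO-functional body body') refl
  SubA-functional (s-app-c A _ _) (s-app-a A' _) with SubA-functional A A'
  ... | ()
  SubA-functional (s-app-a A _) (s-app-c A' _ _) with SubA-functional A A'
  ... | ()
  SubA-functional (s-app-a A M) (s-app-a A' M')
    with SubA-functional A A' | SubO-functional M M'
  ... | refl | refl = refl
  SubA-functional (s-U-c σ N A) (s-U-c σ' N' A')
    with SubF-functional σ σ' | SubO-functional N N'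
  ... | refl | refl with SubA-functional A A'
  ... | refl = refl
  SubA-functional (s-U-c _ _ A) (s-U-a _ _ A') with SubA-functional A A'
  ... | ()
  SubA-functional (s-U-a _ _ A) (s-U-c _ _ A') with SubA-functional A A'
  ... | ()
  SubA-functional (s-U-a σ N A) (s-U-a σ' N' A')
    with SubF-functional σ σ' | SubO-functional N N' | SubA-functional A A'
  ... | refl | refl | refl = refl

  SubO-functional (s-at-a A) (s-at-a A') with SubA-functional A A'
  ... | refl = refl
  SubO-functional (s-at-a A) (s-at-c A') with SubA-functional A A'
  ... | ()
  SubO-functional (s-at-c A) (s-at-a A') with SubA-functional A A'
  ... | ()
  SubO-functional (s-at-c A) (s-at-c A') with SubA-functional A A'
  ... | refl = refl
  SubO-functional (s-lam σ M) (s-lam σ' M') =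
    cong₂ lam (SubF-functional σ σ') (SubO-functional M M')
  SubO-functional (s-Lo σ N M) (s-Lo σ' N' M')
    with SubF-functional σ σ' | SubO-functional N N' | SubO-functional M M'
  ... | refl | refl | refl = refl

  SubC-functional : ∀ {x₀ M₀ ρ₀} {T T' T'' : Ctx} →
                    SubC x₀ M₀ ρ₀ T T' → SubC x₀ M₀ ρ₀ T T'' → T' ≡ T''
  SubC-functional s-∅         s-∅           = refl
  SubC-functional (s-ext Γ σ) (s-ext Γ' σ')
    with SubC-functional Γ Γ' | SubF-functional σ σ'
  ... | refl | refl = refl

  SubA-atomic-canon-disjoint :
    ∀ (x₀ : ℕ) (M₀ : Obj) (ρ₀ : SType) (A A' : Atom) (M : Obj) (ρ : SType) →
    ¬ (SubA x₀ M₀ ρ₀ A (atomic A') × SubA x₀ M₀ ρ₀ A (canon M ρ))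
  SubA-atomic-canon-disjoint _ _ _ _ _ _ _ (toAtom , toCanon)
    with SubA-functional toAtom toCanon
  ... | ()

  ∋-functional : ∀ {Γ x σ σ'} → Γ ∋ x ∶ σ → Γ ∋ x ∶ σ' → σ ≡ σ'
  ∋-functional here      here      = refl
  ∋-functional (there p) (there q) = cong (shiftF 0) (∋-functional p q)

  module _ {Pint : PSym → Sig → Ctx → Obj → Fam → Set} where
    open Typing Pint

    CtxOK⇒SigOK : ∀ {Σ Γ} → CtxOK Σ Γ → SigOK Σ
    CtxOK⇒SigOK (ctx-∅ ⊢Σ)    = ⊢Σ
    CtxOK⇒SigOK (ctx-ext ⊢Γ _) = CtxOK⇒SigOK ⊢Γ

    ∋f-functional : ∀ {Σ a K K'} → SigOK Σ → Σ ∋f a ∶ K → Σ ∋f a ∶ K' → K ≡ K'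
    ∋f-functional _                  here      here      = refl
    ∋f-functional (sig-fam _ _ new)  here      (there q) = ⊥-elim (new (_ , q))
    ∋f-functional (sig-fam _ _ new)  (there p) here      = ⊥-elim (new (_ , p))
    ∋f-functional (sig-fam ⊢Σ _ _)   (there p) (there q) = ∋f-functional ⊢Σ p q
    ∋f-functional (sig-obj ⊢Σ _ _)   (there p) (there q) = ∋f-functional ⊢Σ p q

    ∋o-functional : ∀ {Σ c σ σ'} → SigOK Σ → Σ ∋o c ∶ σ → Σ ∋o c ∶ σ' → σ ≡ σ'
    ∋o-functional _                  here      here      = refl
    ∋o-functional (sig-obj _ _ new)  here      (there q) = ⊥-elim (new (_ , q))
    ∋o-functional (sig-obj _ _ new)  (there p) here      = ⊥-elim (new (_ , p))
    ∋o-functional (sig-fam ⊢Σ _ _)   (there p) (there q) = ∋o-functional ⊢Σ p q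
    ∋o-functional (sig-obj ⊢Σ _ _)   (there p) (there q) = ∋o-functional ⊢Σ p q

    AFamSyn-unique : ∀ {Σ Γ α} {K K' : Kind} →
                     AFamSyn Σ Γ α K → AFamSyn Σ Γ α K' → K ≡ K'
    AFamSyn-unique (af-const ⊢Γ p) (af-const _ q) = ∋f-functional (CtxOK⇒SigOK ⊢Γ) p q
    AFamSyn-unique (af-app α _ K) (af-app α' _ K') with AFamSyn-unique α α'
    ... | refl = SubK-functional K K'

    AtomSyn-unique : ∀ {Σ Γ A} {σ σ' : Fam} →
                     AtomSyn Σ Γ A σ → AtomSyn Σ Γ A σ' → σ ≡ σ'
    AtomSyn-unique (a-const ⊢Γ p) (a-const _ q) = ∋o-functional (CtxOK⇒SigOK ⊢Γ) p q
    AtomSyn-unique (a-var _ p)    (a-var _ q)   = ∋-functional p q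
    AtomSyn-unique (a-app A _ τ) (a-app A' _ τ') with AtomSyn-unique A A'
    ... | refl = SubF-functional τ τ'
    AtomSyn-unique (a-U A _ _) (a-U A' _ _) with AtomSyn-unique A A'
    ... | refl = refl

mainTheorem3 : (PSym : Set) → let open Defs.CLLFP PSym in
    (∀ (x₀ : ℕ) (M₀ : Obj) (ρ₀ : SType) (A A' : Atom) (M : Obj) (ρ : SType) →
      ¬ (SubA x₀ M₀ ρ₀ A (atomic A') × SubA x₀ M₀ ρ₀ A (canon M ρ)))
    ×
    ((∀ {x₀ M₀ ρ₀} {T T' T'' : Kind} →
        SubK x₀ M₀ ρ₀ T T' → SubK x₀ M₀ ρ₀ T T'' → T' ≡ T'')
     × (∀ {x₀ M₀ ρ₀} {T T' T'' : AFam} →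
        SubAF x₀ M₀ ρ₀ T T' → SubAF x₀ M₀ ρ₀ T T'' → T' ≡ T'')
     × (∀ {x₀ M₀ ρ₀} {T T' T'' : Fam} →
        SubF x₀ M₀ ρ₀ T T' → SubF x₀ M₀ ρ₀ T T'' → T' ≡ T'')
     × (∀ {x₀ M₀ ρ₀} {T : Atom} {T' T'' : ARes} →
        SubA x₀ M₀ ρ₀ T T' → SubA x₀ M₀ ρ₀ T T'' → T' ≡ T'')
     × (∀ {x₀ M₀ ρ₀} {T T' T'' : Obj} →
        SubO x₀ M₀ ρ₀ T T' → SubO x₀ M₀ ρ₀ T T'' → T' ≡ T'')
     × (∀ {x₀ M₀ ρ₀} {T T' T'' : Ctx} →
        SubC x₀ M₀ ρ₀ T T' → SubC x₀ M₀ ρ₀ T T'' → T' ≡ T''))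
    ×
    (∀ (Pint : PSym → Sig → Ctx → Obj → Fam → Set) → let open Typing Pint in
      ∀ {Σ Γ α} {K K' : Kind} →
        AFamSyn Σ Γ α K → AFamSyn Σ Γ α K' → K ≡ K')
    ×
    (∀ (Pint : PSym → Sig → Ctx → Obj → Fam → Set) → let open Typing Pint in
      ∀ {Σ Γ A} {σ σ' : Fam} →
        AtomSyn Σ Γ A σ → AtomSyn Σ Γ A σ' → σ ≡ σ')
mainTheorem3 PSym =
    SubA-atomic-canon-disjoint
  , ( SubK-functional , SubAF-functional , SubF-functional
    , SubA-functional , SubO-functional , SubC-functional )
  , (λ _ → AFamSyn-unique)
  , (λ _ → AtomSyn-unique)
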